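{- Let $k\ge 2$ and let $n_1\ge n_2\ge\dots\ge n_k$ be positive integers, and let $N=\sum_{i=1}^k n_i$. Then $$S(L_{n_1}\vee L_{n_2}\vee K_{n_3}\vee K_{n_4}\vee\dots\vee K_{n_k})=2N-n_1-n_2-1.$$ (For $k=2$ the graph is $L_{n_1}\vee L_{n_2}$.)
   Context: For a finite simple graph $G=(V,E)$ and an injective map $f:V\to\mathbb Z$, let $\sigma(G,f)=\{f(v)+f(w): vw\in E\}$. The sum index of $G$ is $S(G)=\min_{f}|\sigma(G,f)|$ over all injective $f:V\to\mathbb Z$. For a positive integer $n$, $L_n$ is the graph with vertex set $\{v_1,\dots,v_n\}$ and edge set $\{v_iv_j: i,j\in[1,n],\ i\ne j,\ i+j\ge n+2\}$. $K_m$ is the complete graph on $m$ vertices. For graphs $G_1,G_2$ (on disjoint vertex sets), the join $G_1\vee G_2$ is obtained from their disjoint union by adding all edges between a vertex of $G_1$ and a vertex of $G_2$. -}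

module Defs where

open import Data.Bool using (Bool; true; false; _∧_; not)
open import Data.Nat using (ℕ; zero; suc; _≤_; _≤ᵇ_)
import Data.Nat as ℕ
open import Data.Fin using (Fin; toℕ; splitAt; _≟_)
import Data.Fin as Fin
open import Data.Integer as ℤ using (ℤ)
open import Data.List using (List; []; _∷_; length; allFin; concatMap; deduplicate)
open import Data.Sum using (_⊎_; inj₁; inj₂)
open import Data.Product using (Σ; _×_; _,_)
open import Relation.Nullary.Decidable using (⌊_⌋)
open import Function.Definitions using (Injective)
open import Relation.Binary.PropositionalEquality using (_≡_)

-- A finite simple graph on the vertex set Fin n, given by a Boolean
-- adjacency function.  All graphs constructed below are symmetric and
-- irreflexive by construction.
Graph : ℕ → Set
Graph n = Fin n → Fin n → Bool

_≢ᵇ_ : ∀ {n} → Fin n → Fin n → Bool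
i ≢ᵇ j = not ⌊ i ≟ j ⌋

K : (n : ℕ) → Graph n
K n i j = i ≢ᵇ j

-- L_n : vertex v_i is Fin index i (0-based, so v_{i+1} in the paper);
-- edge v_a v_b iff a ≠ b and a + b ≥ n + 2 (1-based), i.e.
-- (toℕ i + 1) + (toℕ j + 1) ≥ n + 2.
L : (n : ℕ) → Graph n
L n i j = (i ≢ᵇ j) ∧ ((n ℕ.+ 2) ≤ᵇ (suc (toℕ i) ℕ.+ suc (toℕ j)))

_∨G_ : ∀ {m n} → Graph m → Graph n → Graph (m ℕ.+ n)
_∨G_ {m} G H u v with splitAt m u | splitAt m v
... | inj₁ i | inj₁ j = G i j
... | inj₂ i | inj₂ j = H i j
... | inj₁ _ | inj₂ _ = true
... | inj₂ _ | inj₁ _ = true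

total : (m : ℕ) → (Fin m → ℕ) → ℕ
total zero    ns = 0
total (suc m) ns = ns Fin.zero ℕ.+ total m (λ i → ns (Fin.suc i))

joinK : (m : ℕ) → (ns : Fin m → ℕ) → Graph (total m ns)
joinK zero    ns = λ ()
joinK (suc m) ns = K (ns Fin.zero) ∨G joinK m (λ i → ns (Fin.suc i))

-- The multiset of edge sums f(u)+f(v), listed over ordered adjacent pairs
-- (each edge occurs twice, which does not affect the underlying set).
edgeSums : ∀ {n} → Graph n → (Fin n → ℤ) → List ℤ
edgeSums {n} G f =
  concatMap (λ u → concatMap (λ v → sumIf (G u v) u v) (allFin n)) (allFin n)
  where
  sumIf : Bool → Fin n → Fin n → List ℤ
  sumIf true  u v = f u ℤ.+ f v ∷ []
  sumIf false u v = []

σ-card : ∀ {n} → Graph n → (Fin n → ℤ) → ℕ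
σ-card G f = length (deduplicate ℤ._≟_ (edgeSums G f))

SumIndex : ∀ {n} → Graph n → ℕ → Set
SumIndex {n} G s =
  Σ (Fin n → ℤ) (λ f → Injective _≡_ _≡_ f × σ-card G f ≡ s)
  × ((f : Fin n → ℤ) → Injective _≡_ _≡_ f → s ≤ σ-card G f)

-- Write a = n₁, b = n₂ and c = n₃ + ⋯ + n_k, so that N = a + b + c.
--
-- Upper bound: label L_a by 0, …, a − 1, the complete part by a, …, a + c − 1, and L_b by
-- a + c, …, a + c + b − 1 in reverse order.  The edges of L_b join high indices and so get
-- low labels; every edge sum then lies in [a, 2a + b + 2c − 2], an interval of
-- 2N − a − b − 1 integers.
--
-- Lower bound: give L_a and L_b one colour each and the other c vertices distinct colours.
-- Differently coloured vertices are adjacent, and a complete multipartite graph with N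
-- vertices and r ≥ 2 parts has at least N + r − 3 distinct edge sums (here r = c + 2).  To
-- see this, add the vertices in decreasing order of label, maintaining an increasing chain
-- of edge sums.  Non-adjacency is an equivalence relation, so every edge among the vertices
-- added so far has an endpoint adjacent to the new vertex u.  Hence if u's colour is already
-- present, u plus its least neighbour lies below the whole chain; if it is new, u is
-- adjacent to all vertices added so far and its sums with the two least of them both lie
-- below the chain, unless at most two colours are present, in which case the sums of u with
-- all other vertices already form a long enough chain.

module Submission where

open import Data.Bool using (true; T)
import Data.Bool.Properties as BoolP
open import Data.Fin using (Fin; zero; suc)
import Data.Fin as Fin
import Data.Fin.Properties as FinP
open import Data.Integer as ℤ using (ℤ)
import Data.Integer.Properties as ℤP
open import Data.List using (List; []; _∷_; length; map; filter; _++_; concatMap; allFin; upTo)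
import Data.List.Properties as ListP
open import Data.List.Membership.Propositional using (_∈_; _∉_; lose)
import Data.List.Membership.Propositional.Properties as ∈P
open import Data.List.Relation.Binary.Permutation.Propositional using (_↭_; ↭-sym; ↭⇒↭ₛ)
import Data.List.Relation.Binary.Permutation.Propositional.Properties as ↭P
import Data.List.Relation.Binary.Permutation.Setoid.Properties as ↭ₛP
open import Data.List.Relation.Binary.Subset.Propositional using (_⊆_)
open import Data.List.Relation.Unary.All as All using (All; []; _∷_)
import Data.List.Relation.Unary.All.Properties as AllP
open import Data.List.Relation.Unary.AllPairs as AllPairs using (AllPairs; []; _∷_)
import Data.List.Relation.Unary.AllPairs.Properties as AllPairsP
open import Data.List.Relation.Unary.Any using (Any; here; there; satisfied)
import Data.List.Relation.Unary.Linked.Properties as LinkedP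
open import Data.List.Relation.Unary.Unique.Propositional using (Unique)
import Data.List.Relation.Unary.Unique.Propositional.Properties as UniqueP
open import Data.List.Relation.Unary.Unique.DecPropositional.Properties ℤ._≟_ using (deduplicate-!)
import Data.List.Sort as Sort
open import Data.Nat using (ℕ; zero; suc; _+_; _*_; _∸_; _≤_; _<_; _≤?_; z≤n; s≤s)
import Data.Nat.Properties as ℕP
open import Data.Nat.Tactic.RingSolver using (solve-∀)
open import Data.Product using (Σ; ∃₂; ∃-syntax; _×_; _,_; proj₁; proj₂)
import Data.Product as Product
import Data.Sum as Sum
open import Data.Sum using (_⊎_; inj₁; inj₂)
import Data.Sum.Properties as SumP
open import Function using (_∘_; _∋_; id)
open import Function.Definitions using (Injective; StrictlySurjective)
import Relation.Binary.Construct.On as On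
open import Relation.Binary.Definitions using (DecidableEquality)
open import Relation.Binary.PropositionalEquality
open import Relation.Nullary using (yes; no; ¬?; contradiction)

open import Defs

private
  variable
    A B : Set

unique-⊆⇒length≤ : {xs ys : List A} → Unique xs → xs ⊆ ys → length xs ≤ length ys
unique-⊆⇒length≤ {xs = []} _ _ = z≤n
unique-⊆⇒length≤ {xs = x ∷ xs} (x∉xs ∷ !xs) xs⊆ys
  with pre , post , refl ← ∈P.∈-∃++ (xs⊆ys (here refl)) =
  subst (suc (length xs) ≤_) (sym (↭P.↭-length (↭P.shift x pre post)))
    (s≤s (unique-⊆⇒length≤ !xs drop-x))
  where
  drop-x : xs ⊆ pre ++ post
  drop-x z∈xs with ↭P.∈-resp-↭ (↭P.shift x pre post) (xs⊆ys (there z∈xs))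
  ... | here refl = contradiction refl (All.lookup x∉xs z∈xs)
  ... | there z∈ = z∈

⊆-∷-absorb : ∀ {x : A} {xs ys} → x ∈ ys → xs ⊆ x ∷ ys → xs ⊆ ys
⊆-∷-absorb x∈ys xs⊆ z∈ with xs⊆ z∈
... | here refl = x∈ys
... | there z∈ys = z∈ys

length-allFin : ∀ n → length (allFin n) ≡ n
length-allFin n = ListP.length-tabulate {n = n} id

∈-concatMap⁻-∃ : ∀ {g : A → List B} xs {y} → y ∈ concatMap g xs → ∃[ x ] y ∈ g x
∈-concatMap⁻-∃ {g = g} xs y∈ = satisfied (∈P.∈-concatMap⁻ g {xs} y∈)

module _ (_≟_ : DecidableEquality A) where

  deleteAll : A → List A → List A
  deleteAll x = filter (λ y → ¬? (y ≟ x))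

  length≤suc-deleteAll : ∀ x {xs} → Unique xs → length xs ≤ suc (length (deleteAll x xs))
  length≤suc-deleteAll x {[]} _ = z≤n
  length≤suc-deleteAll x {y ∷ xs} (y∉xs ∷ !xs) with y ≟ x
  ... | yes refl =
    s≤s (ℕP.≤-reflexive (cong length (sym (ListP.filter-all _ (All.map (_∘ sym) y∉xs)))))
  ... | no _ = s≤s (length≤suc-deleteAll x !xs)

  deleteAll-unique : ∀ x {xs} → Unique xs → Unique (deleteAll x xs)
  deleteAll-unique x = UniqueP.filter⁺ (λ y → ¬? (y ≟ x))

  deleteAll-⊆-∷⁻ : ∀ {x xs ys} → xs ⊆ x ∷ ys → deleteAll x xs ⊆ ys
  deleteAll-⊆-∷⁻ {x} xs⊆ y∈ with ∈P.∈-filter⁻ (λ y → ¬? (y ≟ x)) y∈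
  ... | y∈xs , y≢x with xs⊆ y∈xs
  ...   | here y≡x = contradiction y≡x y≢x
  ...   | there y∈ys = y∈ys

module MultipartiteSumChains {V C : Set} (_≟_ : DecidableEquality C) (f : V → ℤ) (colour : V → C) where

  open import Data.List.Membership.DecPropositional _≟_ using (_∈?_)

  Adjacent : V → V → Set
  Adjacent v w = colour v ≢ colour w

  Increasing : List V → Set
  Increasing = AllPairs (λ v w → f v ℤ.< f w)

  record EdgeSum (xs : List V) (s : ℤ) : Set where
    constructor edgeSum
    field
      {lower upper} : V
      lower∈ : lower ∈ xs
      upper∈ : upper ∈ xs
      ordered : f lower ℤ.< f upper
      adjacent : Adjacent lower upper
      sum≡ : s ≡ f lower ℤ.+ f upper

  record SumChain (xs : List V) : Set where
    constructor sumChain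
    field
      sums : List ℤ
      increasing : AllPairs ℤ._<_ sums
      all-edgeSums : All (EdgeSum xs) sums

  open SumChain public

  LongSumChain : List V → ℕ → Set
  LongSumChain xs r = Σ (SumChain xs) λ D → length xs + r ≤ 3 + length (sums D)

  LongSumChain-≤ : ∀ {xs r r′} → r′ ≤ r → LongSumChain xs r → LongSumChain xs r′
  LongSumChain-≤ {xs} r′≤r = Product.map₂ (ℕP.≤-trans (ℕP.+-monoʳ-≤ (length xs) r′≤r))

  head-least : ∀ {x xs w} → Increasing (x ∷ xs) → w ∈ x ∷ xs → f x ℤ.≤ f w
  head-least _ (here refl) = ℤP.≤-refl
  head-least (x< ∷ _) (there w∈) = ℤP.<⇒≤ (All.lookup x< w∈)

  edgeSum-∷ : ∀ {u ys s} → EdgeSum ys s → EdgeSum (u ∷ ys) s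
  edgeSum-∷ (edgeSum p∈ q∈ p<q p≁q refl) = edgeSum (there p∈) (there q∈) p<q p≁q refl

  least-neighbour : ∀ {u ys} → Increasing ys → Any (Adjacent u) ys →
    ∃[ v ] v ∈ ys × Adjacent u v × (∀ {w} → w ∈ ys → Adjacent u w → f v ℤ.≤ f w)
  least-neighbour {u} {y ∷ ys} inc any with colour u ≟ colour y | any
  ... | no u≁y | _ = y , here refl , u≁y , λ w∈ _ → head-least inc w∈
  ... | yes u∼y | here u≁y = contradiction u∼y u≁y
  ... | yes u∼y | there any′ =
    let v , v∈ , u≁v , least = least-neighbour (AllPairs.tail inc) any′
    in v , there v∈ , u≁v , λ where
         (here refl) u≁y → contradiction u∼y u≁y
         (there w∈) u≁w → least w∈ u≁w

  head+least-neighbour< : ∀ {u ys v s} → Increasing (u ∷ ys) → v ∈ ys →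
    (∀ {w} → w ∈ ys → Adjacent u w → f v ℤ.≤ f w) → EdgeSum ys s → f u ℤ.+ f v ℤ.< s
  head+least-neighbour< {u} {v = v} (u< ∷ _) v∈ least (edgeSum {p} {q} p∈ q∈ _ p≁q refl)
    with colour u ≟ colour p
  ... | yes u∼p =
    ℤP.+-mono-<-≤ (All.lookup u< p∈) (least q∈ (λ u∼q → p≁q (trans (sym u∼p) u∼q)))
  ... | no u≁p = subst (f u ℤ.+ f v ℤ.<_) (ℤP.+-comm (f q) (f p))
                   (ℤP.+-mono-<-≤ (All.lookup u< q∈) (least p∈ u≁p))

  head+third< : ∀ {u x₂ x₃ zs s} → Increasing (u ∷ x₂ ∷ x₃ ∷ zs) →
    EdgeSum (x₂ ∷ x₃ ∷ zs) s → f u ℤ.+ f x₃ ℤ.< s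
  head+third< {x₂ = x₂} {x₃} {zs} (u< ∷ inc) (edgeSum {p} p∈ q∈ p<q _ refl) =
    ℤP.+-mono-<-≤ (All.lookup u< p∈) (x₃≤ q∈ p<q)
    where
    x₃≤ : ∀ {q} → q ∈ x₂ ∷ x₃ ∷ zs → f p ℤ.< f q → f x₃ ℤ.≤ f q
    x₃≤ (here refl) p<x₂ =
      contradiction (ℤP.<-≤-trans p<x₂ (head-least inc p∈)) (ℤP.<-irrefl refl)
    x₃≤ (there q∈′) _ = head-least (AllPairs.tail inc) q∈′

  cons-least-neighbour : ∀ {u ys} → Increasing (u ∷ ys) → Any (Adjacent u) ys →
    SumChain ys → SumChain (u ∷ ys)
  cons-least-neighbour {u} inc any (sumChain ss ss↑ ss∈) =
    let v , v∈ , u≁v , least = least-neighbour (AllPairs.tail inc) any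
    in sumChain (f u ℤ.+ f v ∷ ss)
         (All.map (head+least-neighbour< inc v∈ least) ss∈ ∷ ss↑)
         (edgeSum (here refl) (there v∈) (All.lookup (AllPairs.head inc) v∈) u≁v refl
           ∷ All.map edgeSum-∷ ss∈)

  cons-two-neighbours : ∀ {u x₂ x₃ zs} → Increasing (u ∷ x₂ ∷ x₃ ∷ zs) → Adjacent u x₂ →
    Adjacent u x₃ → SumChain (x₂ ∷ x₃ ∷ zs) → SumChain (u ∷ x₂ ∷ x₃ ∷ zs)
  cons-two-neighbours {u} {x₂} {x₃} inc u≁x₂ u≁x₃ (sumChain ss ss↑ ss∈) =
    sumChain (f u ℤ.+ f x₂ ∷ f u ℤ.+ f x₃ ∷ ss)
      ((ux₂<ux₃ ∷ All.map (ℤP.<-trans ux₂<ux₃ ∘ head+third< inc) ss∈)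
        ∷ All.map (head+third< inc) ss∈ ∷ ss↑)
      (edgeSum (here refl) (there (here refl)) (u< (here refl)) u≁x₂ refl
        ∷ edgeSum (here refl) (there (there (here refl))) (u< (there (here refl))) u≁x₃ refl
        ∷ All.map edgeSum-∷ ss∈)
    where
    u< = All.lookup (AllPairs.head inc)
    ux₂<ux₃ : f u ℤ.+ f x₂ ℤ.< f u ℤ.+ f x₃
    ux₂<ux₃ = ℤP.+-monoʳ-< (f u) (All.lookup (AllPairs.head (AllPairs.tail inc)) (here refl))

  star-sumChain : ∀ {u ys} → Increasing (u ∷ ys) → All (Adjacent u) ys →
    Σ (SumChain (u ∷ ys)) λ D → length (sums D) ≡ length ys
  star-sumChain {u} {ys} (u< ∷ inc) u≁ys =
    sumChain (map (λ y → f u ℤ.+ f y) ys)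
      (AllPairsP.map⁺ (AllPairs.map (ℤP.+-monoʳ-< (f u)) inc))
      (AllP.map⁺ (All.tabulate λ y∈ →
        edgeSum (here refl) (there y∈) (All.lookup u< y∈) (All.lookup u≁ys y∈) refl))
    , ListP.length-map _ ys

  adjacent-to-all : ∀ {u ys} → colour u ∉ map colour ys → All (Adjacent u) ys
  adjacent-to-all {ys = ys} u∉ =
    All.tabulate λ y∈ u∼y → u∉ (subst (_∈ map colour ys) (sym u∼y) (∈P.∈-map⁺ colour y∈))

  another-colour : ∀ c {cs} → Unique cs → 2 ≤ length cs → ∃[ d ] d ∈ cs × d ≢ c
  another-colour c {c₁ ∷ c₂ ∷ _} ((c₁≢c₂ ∷ _) ∷ _) _ with c₁ ≟ c
  ... | yes refl = c₂ , there (here refl) , c₁≢c₂ ∘ sym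
  ... | no c₁≢c = c₁ , here refl , c₁≢c
  another-colour c {_ ∷ []} _ (s≤s ())

  repeated-colour-step : ∀ {u ys cs} → Increasing (u ∷ ys) → Unique cs → 2 ≤ length cs →
    cs ⊆ map colour ys → LongSumChain ys (length cs) → LongSumChain (u ∷ ys) (length cs)
  repeated-colour-step {u} {ys} inc !cs 2≤|cs| cs⊆ys (D , bound) =
    cons-least-neighbour inc neighbour D , s≤s bound
    where
    neighbour : Any (Adjacent u) ys
    neighbour
      with d , d∈ , d≢u ← another-colour (colour u) !cs 2≤|cs|
      with y , y∈ , refl ← ∈P.∈-map⁻ colour (cs⊆ys d∈)
      = lose y∈ (d≢u ∘ sym)

  new-colour-step : ∀ {u ys r} → Increasing (u ∷ ys) → colour u ∉ map colour ys →
    2 ≤ length ys → LongSumChain ys r → LongSumChain (u ∷ ys) (suc r)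
  new-colour-step {u} {x₂ ∷ x₃ ∷ zs} {r} inc u∉ _ (D , bound)
    with u≁x₂ ∷ u≁x₃ ∷ _ ← adjacent-to-all u∉ =
    cons-two-neighbours inc u≁x₂ u≁x₃ D ,
    subst (_≤ 3 + (2 + length (sums D))) (cong suc (sym (ℕP.+-suc (length (x₂ ∷ x₃ ∷ zs)) r)))
      (s≤s (s≤s bound))
  new-colour-step {ys = _ ∷ []} _ _ (s≤s ()) _

  new-colour-star : ∀ {u ys r} → Increasing (u ∷ ys) → colour u ∉ map colour ys → r ≤ 2 →
    LongSumChain (u ∷ ys) r
  new-colour-star {u} {ys} {r} inc u∉ r≤2 =
    let D , |D|≡|ys| = star-sumChain inc (adjacent-to-all u∉)
    in D , (begin
      suc (length ys) + r  ≤⟨ ℕP.+-monoʳ-≤ (suc (length ys)) r≤2 ⟩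
      suc (length ys) + 2  ≡⟨ ℕP.+-comm (suc (length ys)) 2 ⟩
      3 + length ys        ≡⟨ cong (3 +_) |D|≡|ys| ⟨
      3 + length (sums D)  ∎)
    where open ℕP.≤-Reasoning

  long-sumChain : ∀ xs → Increasing xs → (cs : List C) → Unique cs → cs ⊆ map colour xs →
    2 ≤ length cs → LongSumChain xs (length cs)
  long-sumChain [] _ (_ ∷ _) _ cs⊆ _ with () ← cs⊆ (here refl)
  long-sumChain (u ∷ ys) inc cs !cs cs⊆ 2≤|cs| with colour u ∈? map colour ys | 3 ≤? length cs
  ... | yes u∈ys | _ =
    repeated-colour-step inc !cs 2≤|cs| cs⊆ys
      (long-sumChain ys (AllPairs.tail inc) cs !cs cs⊆ys 2≤|cs|)
    where
    cs⊆ys : cs ⊆ map colour ys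
    cs⊆ys = ⊆-∷-absorb u∈ys cs⊆
  ... | no u∉ys | no |cs|≱3 = new-colour-star inc u∉ys (ℕP.≤-pred (ℕP.≰⇒> |cs|≱3))
  ... | no u∉ys | yes 3≤|cs| =
    LongSumChain-≤ |cs|≤1+|cs′|
      (new-colour-step inc u∉ys 2≤|ys|
        (long-sumChain ys (AllPairs.tail inc) cs′ !cs′ cs′⊆ys 2≤|cs′|))
    where
    cs′ : List C
    cs′ = deleteAll _≟_ (colour u) cs
    !cs′ : Unique cs′
    !cs′ = deleteAll-unique _≟_ (colour u) !cs
    cs′⊆ys : cs′ ⊆ map colour ys
    cs′⊆ys = deleteAll-⊆-∷⁻ _≟_ cs⊆
    |cs|≤1+|cs′| : length cs ≤ suc (length cs′)
    |cs|≤1+|cs′| = length≤suc-deleteAll _≟_ (colour u) !cs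
    2≤|cs′| : 2 ≤ length cs′
    2≤|cs′| = ℕP.≤-pred (ℕP.≤-trans 3≤|cs| |cs|≤1+|cs′|)
    2≤|ys| : 2 ≤ length ys
    2≤|ys| = begin
      2                       ≤⟨ 2≤|cs′| ⟩
      length cs′              ≤⟨ unique-⊆⇒length≤ !cs′ cs′⊆ys ⟩
      length (map colour ys)  ≡⟨ ListP.length-map colour ys ⟩
      length ys               ∎
      where open ℕP.≤-Reasoning

module _ {n} (G : Graph n) (f : Fin n → ℤ) where

  -- The list of sums contributed by one pair is local to edgeSums, so it is reached through
  -- the type of its injection into edgeSums, in which G v w is then abstracted.
  ∈-edgeSums⁺ : ∀ {v w} → G v w ≡ true → f v ℤ.+ f w ∈ edgeSums G f
  ∈-edgeSums⁺ {v} {w} Gvw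
    with G v w | (λ s∈ → f v ℤ.+ f w ∈ edgeSums G f ∋
                   ∈P.∈-concatMap⁺ _ (lose (∈P.∈-allFin v)
                     (∈P.∈-concatMap⁺ _ (lose (∈P.∈-allFin w) s∈))))
  ... | true | inject = inject (here refl)

  ∈-edgeSums⁻ : ∀ {s} → s ∈ edgeSums G f → ∃₂ λ v w → G v w ≡ true × s ≡ f v ℤ.+ f w
  ∈-edgeSums⁻ s∈
    with v , s∈ᵥ ← ∈-concatMap⁻-∃ (allFin n) s∈
    with w , s∈ᵥw ← ∈-concatMap⁻-∃ (allFin n) s∈ᵥ
    with G v w in Gvw | s∈ᵥw
  ... | true | here s≡ = v , w , Gvw , s≡

  σ-card-≥ : ∀ {ss} → Unique ss → ss ⊆ edgeSums G f → length ss ≤ σ-card G f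
  σ-card-≥ !ss ss⊆ = unique-⊆⇒length≤ !ss (∈P.∈-deduplicate⁺ ℤ._≟_ ∘ ss⊆)

  σ-card-≤ : ∀ {ss} → edgeSums G f ⊆ ss → σ-card G f ≤ length ss
  σ-card-≤ ⊆ss = unique-⊆⇒length≤ (deduplicate-! (edgeSums G f))
    (⊆ss ∘ ∈P.∈-deduplicate⁻ ℤ._≟_ (edgeSums G f))

σ-card-≤-interval : ∀ {n} (G : Graph n) (g : Fin n → ℕ) lo hi →
  (∀ {v w} → G v w ≡ true → lo ≤ g v + g w × g v + g w < hi) →
  σ-card G (ℤ.+_ ∘ g) ≤ hi ∸ lo
σ-card-≤-interval G g lo hi bounds =
  subst (σ-card G (ℤ.+_ ∘ g) ≤_)
    (trans (ListP.length-map _ (upTo (hi ∸ lo))) (ListP.length-upTo (hi ∸ lo)))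
    (σ-card-≤ G (ℤ.+_ ∘ g) ⊆interval)
  where
  interval : List ℤ
  interval = map (λ k → ℤ.+ (lo + k)) (upTo (hi ∸ lo))
  ⊆interval : edgeSums G (ℤ.+_ ∘ g) ⊆ interval
  ⊆interval s∈ with v , w , Gvw , refl ← ∈-edgeSums⁻ G (ℤ.+_ ∘ g) s∈ =
    let lo≤s , s<hi = bounds Gvw
    in subst (_∈ interval) (cong ℤ.+_ (ℕP.m+[n∸m]≡n lo≤s))
         (∈P.∈-map⁺ (λ k → ℤ.+ (lo + k)) (∈P.∈-upTo⁺ (ℕP.∸-monoˡ-< s<hi lo≤s)))

increasing-enumeration : ∀ {n} (f : Fin n → ℤ) → Injective _≡_ _≡_ f →
  ∃[ xs ] xs ↭ allFin n × AllPairs (λ v w → f v ℤ.< f w) xs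
increasing-enumeration {n} f f-inj =
  sort (allFin n) , sort-↭ (allFin n) ,
  AllPairs.zipWith (λ (fv≤fw , v≢w) → ℤP.≤∧≢⇒< fv≤fw (v≢w ∘ f-inj))
    (LinkedP.Linked⇒AllPairs ℤP.≤-trans (sort-↗ (allFin n)) ,
     ↭ₛP.Unique-resp-↭ (setoid (Fin n)) (↭⇒↭ₛ (↭-sym (sort-↭ (allFin n))))
       (UniqueP.allFin⁺ n))
  where open Sort (On.decTotalOrder ℤP.≤-decTotalOrder f)

ContainsCompleteMultipartite : ∀ {n r} → Graph n → (Fin n → Fin r) → Set
ContainsCompleteMultipartite G colour = ∀ v w → colour v ≢ colour w → G v w ≡ true

σ-card-≥-multipartite : ∀ {n r} (G : Graph n) (colour : Fin n → Fin r) →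
  ContainsCompleteMultipartite G colour → StrictlySurjective _≡_ colour → 2 ≤ r →
  (f : Fin n → ℤ) → Injective _≡_ _≡_ f → n + r ≤ 3 + σ-card G f
σ-card-≥-multipartite {n} {r} G colour complete onto 2≤r f f-inj =
  let D , bound = long-sumChain xs xs↑ (allFin r) (UniqueP.allFin⁺ r) colours⊆ 2≤|colours|
  in begin
    n + r                          ≡⟨ cong₂ _+_ |xs|≡n (length-allFin r) ⟨
    length xs + length (allFin r)  ≤⟨ bound ⟩
    3 + length (sums D)            ≤⟨ ℕP.+-monoʳ-≤ 3 (σ-card-≥ G f (sums-unique D) (sums⊆edgeSums D)) ⟩
    3 + σ-card G f                 ∎
  where
  open ℕP.≤-Reasoning
  open MultipartiteSumChains Fin._≟_ f colour
  xs : List (Fin n)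
  xs = proj₁ (increasing-enumeration f f-inj)
  xs↭ : xs ↭ allFin n
  xs↭ = proj₁ (proj₂ (increasing-enumeration f f-inj))
  xs↑ : Increasing xs
  xs↑ = proj₂ (proj₂ (increasing-enumeration f f-inj))
  colours⊆ : allFin r ⊆ map colour xs
  colours⊆ {c} _ with v , refl ← onto c =
    ∈P.∈-map⁺ colour (↭P.∈-resp-↭ (↭-sym xs↭) (∈P.∈-allFin v))
  |xs|≡n : length xs ≡ n
  |xs|≡n = trans (↭P.↭-length xs↭) (length-allFin n)
  2≤|colours| : 2 ≤ length (allFin r)
  2≤|colours| = subst (2 ≤_) (sym (length-allFin r)) 2≤r
  sums-unique : (D : SumChain xs) → Unique (sums D)
  sums-unique D = AllPairs.map ℤP.<⇒≢ (increasing D)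
  sums⊆edgeSums : (D : SumChain xs) → sums D ⊆ edgeSums G f
  sums⊆edgeSums D s∈ with edgeSum _ _ _ p≁q refl ← All.lookup (all-edgeSums D) s∈ =
    ∈-edgeSums⁺ G f (complete _ _ p≁q)

joinColouring : ∀ {m n r s} → (Fin m → Fin r) → (Fin n → Fin s) → Fin (m + n) → Fin (r + s)
joinColouring {m} {n} {r} {s} c d = Fin.join r s ∘ Sum.map c d ∘ Fin.splitAt m

∨G-complete : ∀ {m n r s} {G : Graph m} {H : Graph n} {c : Fin m → Fin r} {d : Fin n → Fin s} →
  ContainsCompleteMultipartite G c → ContainsCompleteMultipartite H d →
  ContainsCompleteMultipartite (G ∨G H) (joinColouring c d)
∨G-complete {m} {r = r} {s} G-complete H-complete v w cv≢cw
  with Fin.splitAt m v | Fin.splitAt m w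
... | inj₁ i | inj₁ j = G-complete i j (cv≢cw ∘ cong (Fin._↑ˡ s))
... | inj₁ _ | inj₂ _ = refl
... | inj₂ _ | inj₁ _ = refl
... | inj₂ i | inj₂ j = H-complete i j (cv≢cw ∘ cong (r Fin.↑ʳ_))

joinColouring-surjective : ∀ {m n r s} {c : Fin m → Fin r} {d : Fin n → Fin s} →
  StrictlySurjective _≡_ c → StrictlySurjective _≡_ d → StrictlySurjective _≡_ (joinColouring c d)
joinColouring-surjective {m} {n} {r} {s} {c} {d} c-onto d-onto y with Fin.splitAt r y in y≡
... | inj₁ y₁ with x , refl ← c-onto y₁ =
  x Fin.↑ˡ n ,
  trans (cong (Fin.join r s ∘ Sum.map c d) (FinP.splitAt-↑ˡ m x n)) (FinP.splitAt⁻¹-↑ˡ y≡)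
... | inj₂ y₂ with x , refl ← d-onto y₂ =
  m Fin.↑ʳ x ,
  trans (cong (Fin.join r s ∘ Sum.map c d) (FinP.splitAt-↑ʳ m n x)) (FinP.splitAt⁻¹-↑ʳ y≡)

monochrome : ∀ {n} → Fin n → Fin 1
monochrome _ = zero

monochrome-surjective : ∀ {n} → 0 < n → StrictlySurjective _≡_ (monochrome {n})
monochrome-surjective 0<n zero = Fin.fromℕ< 0<n , refl

K-complete : ∀ n → ContainsCompleteMultipartite (K n) id
K-complete n v w v≢w with v Fin.≟ w
... | yes v≡w = contradiction v≡w v≢w
... | no _ = refl

joinK-complete : ∀ m ns → ContainsCompleteMultipartite (joinK m ns) id
joinK-complete zero ns ()
joinK-complete (suc m) ns v w v≢w =
  ∨G-complete {c = id} {d = id} (K-complete n₀) (joinK-complete m (ns ∘ suc))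
    v w (λ cv≡cw → v≢w (trans (sym (join-id v)) (trans cv≡cw (join-id w))))
  where
  n₀ : ℕ
  n₀ = ns zero
  join-id : ∀ u → joinColouring {n₀} {total m (ns ∘ suc)} id id u ≡ u
  join-id u = trans (cong (Fin.join _ _) (SumP.map-id (Fin.splitAt n₀ u))) (FinP.join-splitAt n₀ _ u)

σ-card-≥-∨∨complete : ∀ {a b c} (G₁ : Graph a) (G₂ : Graph b) (H : Graph c) →
  ContainsCompleteMultipartite H id → 0 < a → 0 < b →
  (f : Fin (a + (b + c)) → ℤ) → Injective _≡_ _≡_ f →
  a + b + (c + c) ∸ 1 ≤ σ-card (G₁ ∨G (G₂ ∨G H)) f
σ-card-≥-∨∨complete {a} {b} {c} G₁ G₂ H H-complete 0<a 0<b f f-inj =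
  ℕP.∸-monoˡ-≤ 1 (ℕP.+-cancelˡ-≤ 2 _ _ (subst (_≤ 3 + σ-card G f) (regroup a b c)
    (σ-card-≥-multipartite G colour
      (∨G-complete (monochrome-complete G₁) (∨G-complete (monochrome-complete G₂) H-complete))
      (joinColouring-surjective (monochrome-surjective 0<a)
        (joinColouring-surjective (monochrome-surjective 0<b) (λ y → y , refl)))
      (s≤s (s≤s z≤n)) f f-inj)))
  where
  G : Graph (a + (b + c))
  G = G₁ ∨G (G₂ ∨G H)
  monochrome-complete : ∀ {k} (G′ : Graph k) → ContainsCompleteMultipartite G′ monochrome
  monochrome-complete _ _ _ 0≢0 = contradiction refl 0≢0
  colour : Fin (a + (b + c)) → Fin (1 + (1 + c))
  colour = joinColouring (monochrome {a}) (joinColouring (monochrome {b}) id)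
  regroup : ∀ a b c → a + (b + c) + (1 + (1 + c)) ≡ 2 + (a + b + (c + c))
  regroup = solve-∀

splitAt-injective : ∀ m {n} {v w : Fin (m + n)} → Fin.splitAt m v ≡ Fin.splitAt m w → v ≡ w
splitAt-injective m {n} {v} {w} e =
  trans (sym (FinP.join-splitAt m n v)) (trans (cong (Fin.join m n) e) (FinP.join-splitAt m n w))

suc+suc : ∀ m n → suc m + suc n ≡ 2 + (m + n)
suc+suc m n = cong suc (ℕP.+-suc m n)

L-edge : ∀ {n i j} → L n i j ≡ true → n ≤ Fin.toℕ i + Fin.toℕ j
L-edge {n} {i} {j} e =
  ℕP.+-cancelˡ-≤ 2 _ _ (subst₂ _≤_ (ℕP.+-comm n 2) (suc+suc (Fin.toℕ i) (Fin.toℕ j))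
    (ℕP.≤ᵇ⇒≤ _ _ (subst T (sym (BoolP.∧-conicalʳ (i ≢ᵇ j) _ e)) _)))

opposite-sum : ∀ {b} (j j′ : Fin b) → b ≤ Fin.toℕ j + Fin.toℕ j′ →
  suc (Fin.toℕ (Fin.opposite j)) + suc (Fin.toℕ (Fin.opposite j′)) ≤ b
opposite-sum {b} j j′ b≤q+q′ = ℕP.+-cancelʳ-≤ b _ _ (begin
  (suc p + suc p′) + b         ≤⟨ ℕP.+-monoʳ-≤ (suc p + suc p′) b≤q+q′ ⟩
  (suc p + suc p′) + (q + q′)  ≡⟨ regroup p p′ q q′ ⟩
  (p + suc q) + (p′ + suc q′)  ≡⟨ cong₂ _+_ (opposite+suc j) (opposite+suc j′) ⟩
  b + b                        ∎)
  where
  open ℕP.≤-Reasoning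
  p p′ q q′ : ℕ
  p = Fin.toℕ (Fin.opposite j)
  p′ = Fin.toℕ (Fin.opposite j′)
  q = Fin.toℕ j
  q′ = Fin.toℕ j′
  opposite+suc : ∀ k → Fin.toℕ (Fin.opposite k) + suc (Fin.toℕ k) ≡ b
  opposite+suc k =
    trans (cong (_+ suc (Fin.toℕ k)) (FinP.opposite-prop k)) (ℕP.m∸n+n≡m (FinP.toℕ<n k))
  regroup : ∀ p p′ q q′ → (suc p + suc p′) + (q + q′) ≡ (p + suc q) + (p′ + suc q′)
  regroup = solve-∀

opposite-injective : ∀ {b} {k k′ : Fin b} → Fin.opposite k ≡ Fin.opposite k′ → k ≡ k′
opposite-injective {k = k} {k′} e =
  trans (sym (FinP.opposite-involutive k)) (trans (cong Fin.opposite e) (FinP.opposite-involutive k′))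

module L∨L∨-Labelling (a b c : ℕ) (H : Graph c) where

  blockLabel : Fin a ⊎ (Fin b ⊎ Fin c) → ℕ
  blockLabel (inj₁ i) = Fin.toℕ i
  blockLabel (inj₂ (inj₁ j)) = a + c + Fin.toℕ (Fin.opposite j)
  blockLabel (inj₂ (inj₂ k)) = a + Fin.toℕ k

  block : Fin (a + (b + c)) → Fin a ⊎ (Fin b ⊎ Fin c)
  block v = Sum.map₂ (Fin.splitAt b) (Fin.splitAt a v)

  label : Fin (a + (b + c)) → ℕ
  label = blockLabel ∘ block

  toℕ<a+c : (i : Fin a) → Fin.toℕ i < a + c
  toℕ<a+c i = ℕP.<-≤-trans (FinP.toℕ<n i) (ℕP.m≤m+n a c)

  a+toℕ<a+c : (k : Fin c) → a + Fin.toℕ k < a + c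
  a+toℕ<a+c k = ℕP.+-monoʳ-< a (FinP.toℕ<n k)

  blockLabel< : ∀ x → blockLabel x < a + c + b
  blockLabel< (inj₁ i) = ℕP.<-≤-trans (toℕ<a+c i) (ℕP.m≤m+n (a + c) b)
  blockLabel< (inj₂ (inj₁ j)) = ℕP.+-monoʳ-< (a + c) (FinP.toℕ<n (Fin.opposite j))
  blockLabel< (inj₂ (inj₂ k)) = ℕP.<-≤-trans (a+toℕ<a+c k) (ℕP.m≤m+n (a + c) b)

  a≤blockLabel : ∀ y → a ≤ blockLabel (inj₂ y)
  a≤blockLabel (inj₁ j) = ℕP.≤-trans (ℕP.m≤m+n a c) (ℕP.m≤m+n (a + c) _)
  a≤blockLabel (inj₂ k) = ℕP.m≤m+n a _

  blockLabel-injective : ∀ x y → blockLabel x ≡ blockLabel y → x ≡ y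
  blockLabel-injective (inj₁ i) (inj₁ i′) e = cong inj₁ (FinP.toℕ-injective e)
  blockLabel-injective (inj₁ i) (inj₂ y) e =
    contradiction e (ℕP.<⇒≢ (ℕP.<-≤-trans (FinP.toℕ<n i) (a≤blockLabel y)))
  blockLabel-injective (inj₂ x) (inj₁ i) e =
    contradiction (sym e) (ℕP.<⇒≢ (ℕP.<-≤-trans (FinP.toℕ<n i) (a≤blockLabel x)))
  blockLabel-injective (inj₂ (inj₁ j)) (inj₂ (inj₁ j′)) e =
    cong (inj₂ ∘ inj₁) (opposite-injective (FinP.toℕ-injective (ℕP.+-cancelˡ-≡ (a + c) _ _ e)))
  blockLabel-injective (inj₂ (inj₁ j)) (inj₂ (inj₂ k)) e =
    contradiction (sym e) (ℕP.<⇒≢ (ℕP.<-≤-trans (a+toℕ<a+c k) (ℕP.m≤m+n (a + c) _)))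
  blockLabel-injective (inj₂ (inj₂ k)) (inj₂ (inj₁ j)) e =
    contradiction e (ℕP.<⇒≢ (ℕP.<-≤-trans (a+toℕ<a+c k) (ℕP.m≤m+n (a + c) _)))
  blockLabel-injective (inj₂ (inj₂ k)) (inj₂ (inj₂ k′)) e =
    cong (inj₂ ∘ inj₂) (FinP.toℕ-injective (ℕP.+-cancelˡ-≡ a _ _ e))

  block-injective : ∀ {v w} → block v ≡ block w → v ≡ w
  block-injective {v} {w} e with Fin.splitAt a v in v≡ | Fin.splitAt a w in w≡ | e
  ... | inj₁ _ | inj₁ _ | refl = splitAt-injective a (trans v≡ (sym w≡))
  ... | inj₂ _ | inj₂ _ | e′ =
    splitAt-injective a
      (trans v≡ (trans (cong inj₂ (splitAt-injective b (SumP.inj₂-injective e′))) (sym w≡)))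

  label-injective : Injective _≡_ _≡_ label
  label-injective = block-injective ∘ blockLabel-injective _ _

  top : ℕ
  top = (a + c) + (a + c + b)

  sum-bound : ∀ {x y} → x < a + c → y < a + c + b → suc x + suc y ≤ top
  sum-bound = ℕP.+-mono-≤

  sum-bound′ : ∀ {x y} → x < a + c + b → y < a + c → suc x + suc y ≤ top
  sum-bound′ {x} {y} x< y< = subst (_≤ top) (ℕP.+-comm (suc y) (suc x)) (sum-bound y< x<)

  upper-bound-∨ : ∀ {x y} → (L b ∨G H) x y ≡ true →
    suc (blockLabel (inj₂ (Fin.splitAt b x))) + suc (blockLabel (inj₂ (Fin.splitAt b y))) ≤ top
  upper-bound-∨ {x} {y} e with Fin.splitAt b x | Fin.splitAt b y
  ... | inj₁ j | inj₁ j′ = begin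
    suc (a + c + p) + suc (a + c + p′)    ≡⟨ regroup (a + c) p p′ ⟩
    (a + c) + (a + c + (suc p + suc p′))  ≤⟨ ℕP.+-monoʳ-≤ (a + c) (ℕP.+-monoʳ-≤ (a + c) p+p′<b) ⟩
    top                                   ∎
    where
    open ℕP.≤-Reasoning
    p p′ : ℕ
    p = Fin.toℕ (Fin.opposite j)
    p′ = Fin.toℕ (Fin.opposite j′)
    p+p′<b : suc p + suc p′ ≤ b
    p+p′<b = opposite-sum j j′ (L-edge e)
    regroup : ∀ n p p′ → suc (n + p) + suc (n + p′) ≡ n + (n + (suc p + suc p′))
    regroup = solve-∀
  ... | inj₁ j | inj₂ k = sum-bound′ (blockLabel< (inj₂ (inj₁ j))) (a+toℕ<a+c k)
  ... | inj₂ k | y′ = sum-bound (a+toℕ<a+c k) (blockLabel< (inj₂ y′))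

  edge-bounds : ∀ {v w} → (L a ∨G (L b ∨G H)) v w ≡ true →
    a ≤ label v + label w × suc (label v) + suc (label w) ≤ top
  edge-bounds {v} {w} e with Fin.splitAt a v | Fin.splitAt a w
  ... | inj₁ i | inj₁ j =
    L-edge e , sum-bound (toℕ<a+c i) (ℕP.<-≤-trans (toℕ<a+c j) (ℕP.m≤m+n (a + c) b))
  ... | inj₁ i | inj₂ y =
    ℕP.≤-trans (a≤blockLabel (Fin.splitAt b y)) (ℕP.m≤n+m _ (Fin.toℕ i)) ,
    sum-bound (toℕ<a+c i) (blockLabel< (inj₂ (Fin.splitAt b y)))
  ... | inj₂ x | inj₁ j =
    ℕP.≤-trans (a≤blockLabel (Fin.splitAt b x)) (ℕP.m≤m+n _ (Fin.toℕ j)) ,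
    sum-bound′ (blockLabel< (inj₂ (Fin.splitAt b x))) (toℕ<a+c j)
  ... | inj₂ x | inj₂ y =
    ℕP.≤-trans (a≤blockLabel (Fin.splitAt b x)) (ℕP.m≤m+n _ _) , upper-bound-∨ e

  σ-card-label : σ-card (L a ∨G (L b ∨G H)) (ℤ.+_ ∘ label) ≤ a + b + (c + c) ∸ 1
  σ-card-label =
    subst (σ-card (L a ∨G (L b ∨G H)) (ℤ.+_ ∘ label) ≤_) interval-length
      (σ-card-≤-interval _ label a (top ∸ 1) λ e →
        let lower , upper = edge-bounds e
        in lower , ℕP.∸-monoˡ-≤ 1 (subst (_≤ top) (suc+suc _ _) upper))
    where
    open ≡-Reasoning
    regroup : ∀ a b c → (a + c) + (a + c + b) ≡ a + (a + b + (c + c))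
    regroup = solve-∀
    interval-length : top ∸ 1 ∸ a ≡ a + b + (c + c) ∸ 1
    interval-length = begin
      top ∸ 1 ∸ a                      ≡⟨ cong (λ t → t ∸ 1 ∸ a) (regroup a b c) ⟩
      a + (a + b + (c + c)) ∸ 1 ∸ a    ≡⟨ ℕP.∸-+-assoc (a + (a + b + (c + c))) 1 a ⟩
      a + (a + b + (c + c)) ∸ (1 + a)  ≡⟨ cong (a + (a + b + (c + c)) ∸_) (ℕP.+-comm 1 a) ⟩
      a + (a + b + (c + c)) ∸ (a + 1)  ≡⟨ ℕP.∸-+-assoc _ a 1 ⟨
      a + (a + b + (c + c)) ∸ a ∸ 1    ≡⟨ cong (_∸ 1) (ℕP.m+n∸m≡n a _) ⟩
      a + b + (c + c) ∸ 1              ∎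

sumIndex-L∨L∨complete : ∀ {a b c} (H : Graph c) → ContainsCompleteMultipartite H id →
  0 < a → 0 < b → SumIndex (L a ∨G (L b ∨G H)) (a + b + (c + c) ∸ 1)
sumIndex-L∨L∨complete {a} {b} {c} H H-complete 0<a 0<b =
  (ℤ.+_ ∘ label , +label-injective , ℕP.≤-antisym σ-card-label (lower _ +label-injective)) , lower
  where
  open L∨L∨-Labelling a b c H
  +label-injective : Injective _≡_ _≡_ (ℤ.+_ ∘ label)
  +label-injective = label-injective ∘ ℤP.+-injective
  lower : ∀ f → Injective _≡_ _≡_ f → a + b + (c + c) ∸ 1 ≤ σ-card (L a ∨G (L b ∨G H)) f
  lower = σ-card-≥-∨∨complete (L a) (L b) H H-complete 0<a 0<b

2*[a+[b+c]]∸a∸b : ∀ a b c → 2 * (a + (b + c)) ∸ a ∸ b ≡ a + b + (c + c)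
2*[a+[b+c]]∸a∸b a b c = begin
  2 * (a + (b + c)) ∸ a ∸ b        ≡⟨ cong (λ x → x ∸ a ∸ b) (regroup a b c) ⟩
  a + b + (c + c) + b + a ∸ a ∸ b  ≡⟨ cong (_∸ b) (ℕP.m+n∸n≡m _ a) ⟩
  a + b + (c + c) + b ∸ b          ≡⟨ ℕP.m+n∸n≡m _ b ⟩
  a + b + (c + c)                  ∎
  where
  open ≡-Reasoning
  regroup : ∀ a b c → 2 * (a + (b + c)) ≡ a + b + (c + c) + b + a
  regroup = solve-∀

theorem2p2 : (m : ℕ) → (ns : Fin (suc (suc m)) → ℕ)
    → (∀ i → 1 ≤ ns i)
    → (∀ i j → i Fin.≤ j → ns j ≤ ns i)
    → SumIndex (L (ns zero) ∨G (L (ns (suc zero)) ∨G joinK m (λ i → ns (suc (suc i)))))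
        (2 * total (suc (suc m)) ns ∸ ns zero ∸ ns (suc zero) ∸ 1)
theorem2p2 m ns pos _ =
  subst (SumIndex _) (cong (_∸ 1) (sym (2*[a+[b+c]]∸a∸b (ns zero) (ns (suc zero)) c)))
    (sumIndex-L∨L∨complete (joinK m _) (joinK-complete m _) (pos zero) (pos (suc zero)))
  where
  c : ℕ
  c = total m (λ i → ns (suc (suc i)))
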